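{- Suppose there exist $m$ mutually orthogonal Latin squares of order $n$. Then there exists a resolvable semi-regular STD$(n)$ rectangular design with parameters $v=mn$, $b=n(n-1)$, $r=n-1$, $k=m$, $\lambda_1=\lambda_2=0$, $\lambda_3=1$, $m$, $n$.
   Context: A Latin square of order $n$ is an $n\times n$ array on $n$ symbols with each symbol exactly once in each row and column; two are orthogonal if superimposing them yields every ordered pair of symbols exactly once; a set is mutually orthogonal if pairwise orthogonal. A rectangular design (RD) with parameters $v=mn,b,r,k,\lambda_1,\lambda_2,\lambda_3,m,n$ has its treatments arranged in an $m\times n$ array, $b$ blocks of size $k$, replication $r$, and any two distinct treatments occur together in $\lambda_1$ blocks if in the same row, $\lambda_2$ if in the same column, $\lambda_3$ otherwise. With $\theta_1=r-\lambda_1+(m-1)(\lambda_2-\lambda_3)$, $\theta_2=r-\lambda_2+(n-1)(\lambda_1-\lambda_3)$, $\theta_3=r-\lambda_1-\lambda_2+\lambda_3$, the RD is semi-regular if exactly one of $\theta_1,\theta_2$ is $0$ and the other two $\theta$'s are positive. It is STD$(n)$ if its incidence matrix (rows grouped by rows of the array) is partitioned into $n\times n$ submatrices each having constant row sums and constant column sums. It is resolvable if the blocks can be partitioned into classes each containing every treatment exactly once. -}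

module Defs where

open import Data.Nat using (ℕ; zero; suc; _+_; _*_; _∸_)
open import Data.Integer as ℤ using (ℤ; +_; +<+; _-_) renaming (_+_ to _+ℤ_; _*_ to _*ℤ_; _<_ to _<ℤ_)
open import Data.Fin using (Fin)
import Data.Fin as F
open import Data.Bool using (Bool; true; false; if_then_else_; _∧_)
open import Data.Product using (Σ; _×_; _,_; ∃)
open import Data.Sum using (_⊎_)
open import Relation.Binary.PropositionalEquality using (_≡_; _≢_)

count : (n : ℕ) → (Fin n → Bool) → ℕ
count zero    f = 0
count (suc n) f = (if f F.zero then 1 else 0) + count n (λ x → f (F.suc x))

sumF : (n : ℕ) → (Fin n → ℕ) → ℕ
sumF zero    f = 0
sumF (suc n) f = f F.zero + sumF n (λ x → f (F.suc x))

count2 : (m n : ℕ) → (Fin m → Fin n → Bool) → ℕ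
count2 m n f = sumF m (λ i → count n (f i))

-- a Latin square of order n on symbol set Fin n: cell (row , column) ↦ symbol
Square : ℕ → Set
Square n = Fin n → Fin n → Fin n

IsLatin : (n : ℕ) → Square n → Set
IsLatin n L =
  (∀ (i s : Fin n) → Σ (Fin n) λ j → L i j ≡ s × (∀ j′ → L i j′ ≡ s → j′ ≡ j)) ×
  (∀ (j s : Fin n) → Σ (Fin n) λ i → L i j ≡ s × (∀ i′ → L i′ j ≡ s → i′ ≡ i))

Orthogonal : (n : ℕ) → Square n → Square n → Set
Orthogonal n L M =
  ∀ (s t : Fin n) → Σ (Fin n × Fin n) λ { (i , j) →
    (L i j ≡ s × M i j ≡ t) ×
    (∀ i′ j′ → L i′ j′ ≡ s → M i′ j′ ≡ t → (i′ , j′) ≡ (i , j)) }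

MOLS : (m n : ℕ) → Set
MOLS m n = Σ (Fin m → Square n) λ L →
  (∀ a → IsLatin n (L a)) × (∀ a c → a ≢ c → Orthogonal n (L a) (L c))

-- Rectangular designs
-- Treatments are the cells (i , j) of an m × n array (so v = m n),
-- blocks are indexed by Fin b, and N i j β ≡ true iff treatment (i , j)
-- lies in block β (the incidence matrix).

Incidence : (m n b : ℕ) → Set
Incidence m n b = Fin m → Fin n → Fin b → Bool

concurrence : ∀ {m n b} → Incidence m n b → Fin m → Fin n → Fin m → Fin n → ℕ
concurrence {b = b} N i j i′ j′ = count b (λ β → N i j β ∧ N i′ j′ β)

record IsRD (m n b r k l₁ l₂ l₃ : ℕ) (N : Incidence m n b) : Set where
  field
    blockSize   : ∀ (β : Fin b) → count2 m n (λ i j → N i j β) ≡ k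
    replication : ∀ (i : Fin m) (j : Fin n) → count b (N i j) ≡ r
    sameRow     : ∀ (i : Fin m) (j j′ : Fin n) → j ≢ j′ → concurrence N i j i j′ ≡ l₁
    sameColumn  : ∀ (i i′ : Fin m) (j : Fin n) → i ≢ i′ → concurrence N i j i′ j ≡ l₂
    otherwise   : ∀ (i i′ : Fin m) (j j′ : Fin n) → i ≢ i′ → j ≢ j′ →
                  concurrence N i j i′ j′ ≡ l₃

θ₁ θ₂ θ₃ : (m n r l₁ l₂ l₃ : ℕ) → ℤ
θ₁ m n r l₁ l₂ l₃ = (+ r - + l₁) +ℤ ((+ m - + 1) *ℤ (+ l₂ - + l₃))
θ₂ m n r l₁ l₂ l₃ = (+ r - + l₂) +ℤ ((+ n - + 1) *ℤ (+ l₁ - + l₃))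
θ₃ m n r l₁ l₂ l₃ = ((+ r - + l₁) - + l₂) +ℤ + l₃

SemiRegular : (m n r l₁ l₂ l₃ : ℕ) → Set
SemiRegular m n r l₁ l₂ l₃ =
  (θ₁ m n r l₁ l₂ l₃ ≡ + 0 × + 0 <ℤ θ₂ m n r l₁ l₂ l₃ × + 0 <ℤ θ₃ m n r l₁ l₂ l₃) ⊎
  (θ₂ m n r l₁ l₂ l₃ ≡ + 0 × + 0 <ℤ θ₁ m n r l₁ l₂ l₃ × + 0 <ℤ θ₃ m n r l₁ l₂ l₃)

-- STD(n): the columns (blocks) of the incidence matrix can be partitioned into
-- groups of n blocks such that, with rows grouped by the rows of the array
-- (n treatments each), every n × n submatrix has constant row sums and
-- constant column sums.
STD : ∀ {m n b} → Incidence m n b → Set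
STD {m} {n} {b} N =
  Σ ℕ λ c → Σ (Fin b → Fin c) λ grp →
    (∀ (g : Fin c) → count b (λ β → ⌊ grp β ≟ g ⌋) ≡ n) ×
    (∀ (i : Fin m) (g : Fin c) →
       (Σ ℕ λ ρ → ∀ (j : Fin n) → count b (λ β → ⌊ grp β ≟ g ⌋ ∧ N i j β) ≡ ρ) ×
       (Σ ℕ λ κ → ∀ (β : Fin b) → grp β ≡ g → count n (λ j → N i j β) ≡ κ))
  where
  open import Data.Fin using (_≟_)
  open import Relation.Nullary.Decidable using (⌊_⌋)

Resolvable : ∀ {m n b} → Incidence m n b → Set
Resolvable {m} {n} {b} N =
  Σ ℕ λ c → Σ (Fin b → Fin c) λ cls →
    ∀ (q : Fin c) (i : Fin m) (j : Fin n) →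
      count b (λ β → ⌊ cls β ≟ q ⌋ ∧ N i j β) ≡ 1
  where
  open import Data.Fin using (_≟_)
  open import Relation.Nullary.Decidable using (⌊_⌋)

-- Name the symbols of each square by their columns in row 0: treatment (a , s) is the symbol
-- L a 0 s of square a, and each cell (1 + x , y) outside row 0 is a block containing, from every
-- square, the symbol written in that cell.  Row Latinity gives one treatment per square in each
-- block and replication n - 1; two treatments of one square, or the same position in two squares,
-- never share a cell, while orthogonality puts any other pair in exactly one cell, which cannot
-- lie in row 0.  The blocks of a row x form a parallel class, and the classes are the groups of
-- the STD(n) partition.  Finally m ≤ n - 1 (the usual bound on MOLS) makes θ₁ = n - m positive,
-- while θ₂ = 0 and θ₃ = n.
module Submission where

open import Defs
open import Data.Nat using (ℕ; _*_; _∸_; _≤_)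
open import Data.Product using (Σ; _×_)

open import Data.Bool using (Bool; true; false; T; if_then_else_; _∧_)
open import Data.Bool.Properties using (T-∧)
open import Data.Empty using (⊥-elim)
open import Data.Fin using (Fin; zero; suc; _↑ˡ_; _↑ʳ_; combine; remQuot; punchOut; _≟_)
open import Data.Fin.Properties
  using (0≢1+n; suc-injective; remQuot-combine; combine-remQuot; punchOut-injective; injective⇒≤)
open import Data.Integer as ℤ using (+<+; _-_) renaming (_+_ to _+ℤ_; _*_ to _*ℤ_)
open import Data.Integer.Tactic.RingSolver using (solve-∀)
open import Data.Nat using (zero; suc; _+_; s≤s; z≤n)
import Data.Nat.Properties as ℕ
open import Algebra.Properties.CommutativeSemigroup ℕ.+-commutativeSemigroup using (interchange)
open import Data.Product using (∃; _,_; proj₁; proj₂; uncurry)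
open import Data.Product.Properties using (,-injective)
open import Data.Sum using (inj₂)
open import Function using (_∘_; Injective)
open import Function.Bundles using (Equivalence)
open import Relation.Binary.PropositionalEquality
open import Relation.Nullary using (¬_; yes; no)
open import Relation.Nullary.Decidable using (⌊_⌋; toWitness; fromWitness)

open Equivalence using (to; from)
open ≡-Reasoning

sumF-cong : ∀ n {f g : Fin n → ℕ} → (∀ x → f x ≡ g x) → sumF n f ≡ sumF n g
sumF-cong zero    f≗g = refl
sumF-cong (suc n) f≗g = cong₂ _+_ (f≗g zero) (sumF-cong n (f≗g ∘ suc))

sumF-constant : ∀ n {c} {f : Fin n → ℕ} → (∀ x → f x ≡ c) → sumF n f ≡ n * c
sumF-constant zero    f≗c = refl
sumF-constant (suc n) f≗c = cong₂ _+_ (f≗c zero) (sumF-constant n (f≗c ∘ suc))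

sumF-ones : ∀ n {f : Fin n → ℕ} → (∀ x → f x ≡ 1) → sumF n f ≡ n
sumF-ones n f≗1 = trans (sumF-constant n f≗1) (ℕ.*-identityʳ n)

sumF-+ : ∀ n (f g : Fin n → ℕ) → sumF n f + sumF n g ≡ sumF n (λ x → f x + g x)
sumF-+ zero    f g = refl
sumF-+ (suc n) f g = trans (interchange (f zero) _ (g zero) _)
                           (cong ((f zero + g zero) +_) (sumF-+ n (f ∘ suc) (g ∘ suc)))

sumF-swap : ∀ n k (h : Fin n → Fin k → ℕ) →
            sumF n (λ y → sumF k (h y)) ≡ sumF k (λ x → sumF n (λ y → h y x))
sumF-swap zero    k h = sym (trans (sumF-constant k (λ _ → refl)) (ℕ.*-zeroʳ k))
sumF-swap (suc n) k h = trans (cong (sumF k (h zero) +_) (sumF-swap n k (h ∘ suc)))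
                              (sumF-+ k (h zero) _)

count-cong : ∀ n {f g : Fin n → Bool} → (∀ x → f x ≡ g x) → count n f ≡ count n g
count-cong zero    f≗g = refl
count-cong (suc n) f≗g = cong₂ _+_ (cong (λ b → if b then 1 else 0) (f≗g zero))
                                   (count-cong n (f≗g ∘ suc))

count-none : ∀ n {f : Fin n → Bool} → (∀ x → ¬ T (f x)) → count n f ≡ 0
count-none zero    none = refl
count-none (suc n) {f} none with f zero | none zero
... | true  | ¬f0 = ⊥-elim (¬f0 _)
... | false | _   = count-none n (none ∘ suc)

count-unique : ∀ n {f : Fin n → Bool} (x : Fin n) → T (f x) →
               (∀ y → T (f y) → y ≡ x) → count n f ≡ 1
count-unique (suc n) {f} zero    f0 unique with f zero
... | true = cong suc (count-none n (λ y fy → 0≢1+n (sym (unique (suc y) fy))))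
count-unique (suc n) {f} (suc x) fx unique with f zero | unique zero
... | true  | u = ⊥-elim (0≢1+n (u _))
... | false | _ = count-unique n x fx (λ y fy → suc-injective (unique (suc y) fy))

count-≟ : ∀ n (x : Fin n) → count n (λ y → ⌊ y ≟ x ⌋) ≡ 1
count-≟ n x = count-unique n x (fromWitness refl) (λ _ → toWitness)

count-sumF : ∀ n (f : Fin n → Bool) → count n f ≡ sumF n (λ x → if f x then 1 else 0)
count-sumF zero    f = refl
count-sumF (suc n) f = cong ((if f zero then 1 else 0) +_) (count-sumF n (f ∘ suc))

count-swap : ∀ n k (h : Fin n → Fin k → Bool) →
             sumF n (λ y → count k (h y)) ≡ sumF k (λ x → count n (λ y → h y x))
count-swap n k h = begin
  sumF n (λ y → count k (h y))
    ≡⟨ sumF-cong n (λ y → count-sumF k (h y)) ⟩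
  sumF n (λ y → sumF k (λ x → if h y x then 1 else 0))
    ≡⟨ sumF-swap n k _ ⟩
  sumF k (λ x → sumF n (λ y → if h y x then 1 else 0))
    ≡⟨ sumF-cong k (λ x → count-sumF n (λ y → h y x)) ⟨
  sumF k (λ x → count n (λ y → h y x)) ∎

count-++ : ∀ k l (f : Fin (k + l) → Bool) →
           count (k + l) f ≡ count k (λ i → f (i ↑ˡ l)) + count l (λ j → f (k ↑ʳ j))
count-++ zero    l f = refl
count-++ (suc k) l f = trans (cong ((if f zero then 1 else 0) +_) (count-++ k l (f ∘ suc)))
                             (sym (ℕ.+-assoc (if f zero then 1 else 0) _ _))

count-combine : ∀ n k (f : Fin (n * k) → Bool) →
                count (n * k) f ≡ sumF n (λ y → count k (λ x → f (combine y x)))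
count-combine zero    k f = refl
count-combine (suc n) k f = trans (count-++ k (n * k) f)
                                  (cong (count k (λ x → f (x ↑ˡ n * k)) +_) (count-combine n k (f ∘ (k ↑ʳ_))))

count-remQuot : ∀ n k (f : Fin n × Fin k → Bool) →
                count (n * k) (f ∘ remQuot {n} k) ≡ sumF n (λ y → count k (λ x → f (y , x)))
count-remQuot n k f = trans (count-combine n k (f ∘ remQuot {n} k))
  (sumF-cong n (λ y → count-cong k (λ x → cong f (remQuot-combine y x))))

count-unique-remQuot : ∀ n k {f : Fin n × Fin k → Bool} (p : Fin n × Fin k) → T (f p) →
                       (∀ q → T (f q) → q ≡ p) → count (n * k) (f ∘ remQuot {n} k) ≡ 1
count-unique-remQuot n k {f} (y , x) fp unique =
  count-unique (n * k) (combine y x) (subst (T ∘ f) (sym (remQuot-combine y x)) fp)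
    λ β fβ → trans (sym (combine-remQuot {n} k β)) (cong (uncurry combine) (unique _ fβ))

module _ {n} {L : Square n} (latin : IsLatin n L) where

  latin-row-surjective : ∀ i s → ∃ λ j → L i j ≡ s
  latin-row-surjective i s = let j , Lij≡s , _ = proj₁ latin i s in j , Lij≡s

  latin-row-injective : ∀ i → Injective _≡_ _≡_ (L i)
  latin-row-injective i {j} {j′} Lij≡Lij′ =
    let _ , _ , unique = proj₁ latin i (L i j′) in trans (unique j Lij≡Lij′) (sym (unique j′ refl))

  latin-column-injective : ∀ j → Injective _≡_ _≡_ (λ i → L i j)
  latin-column-injective j {i} {i′} Lij≡Li′j =
    let _ , _ , unique = proj₂ latin j (L i′ j) in trans (unique i Lij≡Li′j) (sym (unique i′ refl))

orthogonal-injective : ∀ {n} {L M : Square n} → Orthogonal n L M → ∀ {i j i′ j′} →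
                       L i j ≡ L i′ j′ → M i j ≡ M i′ j′ → (i , j) ≡ (i′ , j′)
orthogonal-injective {L = L} {M} orth {i} {j} {i′} {j′} L≡ M≡ =
  let _ , _ , unique = orth (L i′ j′) (M i′ j′) in trans (unique i j L≡ M≡) (sym (unique i′ j′ refl refl))

-- Each square writes the symbol of cell (1 , 0) at some column σ a ≠ 0 of row 0, and
-- orthogonality makes σ injective.
MOLS-bound : ∀ {m k} → MOLS m (2 + k) → m ≤ 1 + k
MOLS-bound {m} {k} (L , latin , orthogonal) = injective⇒≤ τ-injective
  where
  σ : Fin m → Fin (2 + k)
  σ a = proj₁ (latin-row-surjective (latin a) zero (L a (suc zero) zero))

  σ-spec : ∀ a → L a zero (σ a) ≡ L a (suc zero) zero
  σ-spec a = proj₂ (latin-row-surjective (latin a) zero (L a (suc zero) zero))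

  0≢σ : ∀ a → zero ≢ σ a
  0≢σ a 0≡σa = 0≢1+n (latin-column-injective (latin a) zero (trans (cong (L a zero) 0≡σa) (σ-spec a)))

  σ-injective : Injective _≡_ _≡_ σ
  σ-injective {a} {c} σa≡σc with a ≟ c
  ... | yes a≡c = a≡c
  ... | no  a≢c = ⊥-elim (0≢1+n (sym (cong proj₁ cells≡)))
    where
    cells≡ : (suc zero , zero) ≡ (zero , σ a)
    cells≡ = orthogonal-injective (orthogonal a c a≢c)
               (sym (σ-spec a)) (trans (sym (σ-spec c)) (cong (L c zero) (sym σa≡σc)))

  τ : Fin m → Fin (1 + k)
  τ a = punchOut (0≢σ a)

  τ-injective : Injective _≡_ _≡_ τ
  τ-injective {a} {c} = σ-injective ∘ punchOut-injective (0≢σ a) (0≢σ c)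

θ₁-value : ∀ m n d → θ₁ m n (m + d) 0 0 1 ≡ ℤ.+ suc d
θ₁-value m n d = lemma (ℤ.+ m) (ℤ.+ d)
  where
  lemma : ∀ x y → ((x +ℤ y) - ℤ.+ 0) +ℤ ((x - ℤ.+ 1) *ℤ (ℤ.+ 0 - ℤ.+ 1)) ≡ ℤ.+ 1 +ℤ y
  lemma = solve-∀

θ₂-value : ∀ m r → θ₂ m (suc r) r 0 0 1 ≡ ℤ.+ 0
θ₂-value m r = lemma (ℤ.+ r)
  where
  lemma : ∀ x → (x - ℤ.+ 0) +ℤ (((ℤ.+ 1 +ℤ x) - ℤ.+ 1) *ℤ (ℤ.+ 0 - ℤ.+ 1)) ≡ ℤ.+ 0
  lemma = solve-∀

θ₃-value : ∀ m n r → θ₃ m n r 0 0 1 ≡ ℤ.+ suc r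
θ₃-value m n r = lemma (ℤ.+ r)
  where
  lemma : ∀ x → ((x - ℤ.+ 0) - ℤ.+ 0) +ℤ ℤ.+ 1 ≡ ℤ.+ 1 +ℤ x
  lemma = solve-∀

semiRegular : ∀ {m r} → m ≤ r → SemiRegular m (suc r) r 0 0 1
semiRegular {m} {r} m≤r with ℕ.m≤n⇒∃[o]m+o≡n m≤r
... | d , refl = inj₂ (θ₂-value m r , positive (θ₁-value m (suc r) d) , positive (θ₃-value m (suc r) r))
  where
  positive : ∀ {z k} → z ≡ ℤ.+ suc k → ℤ.+ 0 ℤ.< z
  positive refl = +<+ (s≤s z≤n)

module Construction {m k : ℕ} (L : Fin m → Square (2 + k))
  (latin : ∀ a → IsLatin (2 + k) (L a))
  (orthogonal : ∀ a c → a ≢ c → Orthogonal (2 + k) (L a) (L c)) where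

  n r : ℕ
  n = 2 + k
  r = 1 + k

  -- The block (y , x) is the cell (1 + x , y) and treatment (a , s) is the symbol L a 0 s of square a.
  contains : Fin m → Fin n → Fin n × Fin r → Bool
  contains a s (y , x) = ⌊ L a (suc x) y ≟ L a zero s ⌋

  incidence : Incidence m n (n * r)
  incidence a s = contains a s ∘ remQuot {n} r

  parallelClass : Fin (n * r) → Fin r
  parallelClass = proj₂ ∘ remQuot {n} r

  contains-sound : ∀ {a s} y x → T (contains a s (y , x)) → L a (suc x) y ≡ L a zero s
  contains-sound {a} {s} y x = toWitness {a? = L a (suc x) y ≟ L a zero s}

  contains-complete : ∀ {a s} y x → L a (suc x) y ≡ L a zero s → T (contains a s (y , x))
  contains-complete y x = fromWitness

  row0-injective : ∀ a → Injective _≡_ _≡_ (L a zero)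
  row0-injective a = latin-row-injective (latin a) zero

  contains-once-per-square : ∀ a p → count n (λ s → contains a s p) ≡ 1
  contains-once-per-square a (y , x) =
    let s , L0s≡ = latin-row-surjective (latin a) zero (L a (suc x) y)
    in count-unique n s (contains-complete y x (sym L0s≡))
         λ t h → row0-injective a (trans (sym (contains-sound y x h)) (sym L0s≡))

  blockSize : ∀ β → count2 m n (λ a s → incidence a s β) ≡ m
  blockSize β = sumF-ones m (λ a → contains-once-per-square a (remQuot r β))

  contained-once-per-row : ∀ a s x → count n (λ y → contains a s (y , x)) ≡ 1
  contained-once-per-row a s x =
    let y , Ly≡ = latin-row-surjective (latin a) (suc x) (L a zero s)
    in count-unique n y (contains-complete y x Ly≡)
         λ y′ h → latin-row-injective (latin a) (suc x) (trans (contains-sound y′ x h) (sym Ly≡))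

  replication : ∀ a s → count (n * r) (incidence a s) ≡ r
  replication a s = begin
    count (n * r) (incidence a s)                           ≡⟨ count-remQuot n r (contains a s) ⟩
    sumF n (λ y → count r (λ x → contains a s (y , x)))   ≡⟨ count-swap n r (λ y x → contains a s (y , x)) ⟩
    sumF r (λ x → count n (λ y → contains a s (y , x)))   ≡⟨ sumF-ones r (contained-once-per-row a s) ⟩
    r                                                       ∎

  contains-both : ∀ a s c t y x → T (contains a s (y , x) ∧ contains c t (y , x)) →
                  L a (suc x) y ≡ L a zero s × L c (suc x) y ≡ L c zero t
  contains-both a s c t y x h =
    let hs , ht = to (T-∧ {contains a s (y , x)}) h in contains-sound y x hs , contains-sound y x ht

  sameRow : ∀ a s t → s ≢ t → concurrence incidence a s a t ≡ 0
  sameRow a s t s≢t = count-none (n * r) λ β h →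
    let y , x = remQuot {n} r β
        Las≡ , Lat≡ = contains-both a s a t y x h
    in s≢t (row0-injective a (trans (sym Las≡) Lat≡))

  sameColumn : ∀ a c s → a ≢ c → concurrence incidence a s c s ≡ 0
  sameColumn a c s a≢c = count-none (n * r) λ β h →
    let y , x = remQuot {n} r β
        La≡ , Lc≡ = contains-both a s c s y x h
    in 0≢1+n (sym (cong proj₁ (orthogonal-injective (orthogonal a c a≢c) La≡ Lc≡)))

  -- The unique cell carrying the pair (L a 0 s , L c 0 t) cannot lie in row 0, as s ≢ t.
  otherwise : ∀ a c s t → a ≢ c → s ≢ t → concurrence incidence a s c t ≡ 1
  otherwise a c s t a≢c s≢t with orthogonal a c a≢c (L a zero s) (L c zero t)
  ... | (zero , j) , (Laj≡ , Lcj≡) , _ =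
    ⊥-elim (s≢t (trans (sym (row0-injective a Laj≡)) (row0-injective c Lcj≡)))
  ... | (suc x , y) , (Lay≡ , Lcy≡) , _ =
    count-unique-remQuot n r (y , x)
      (from (T-∧ {contains a s (y , x)}) (contains-complete y x Lay≡ , contains-complete y x Lcy≡))
      unique
    where
    unique : ∀ p → T (contains a s p ∧ contains c t p) → p ≡ (y , x)
    unique (y′ , x′) h =
      let La≡ , Lc≡ = contains-both a s c t y′ x′ h
          x≡ , y≡ = ,-injective (orthogonal-injective (orthogonal a c a≢c)
                      (trans La≡ (sym Lay≡)) (trans Lc≡ (sym Lcy≡)))
      in cong₂ _,_ y≡ (suc-injective x≡)

  isRD : IsRD m n (n * r) r m 0 0 1 incidence
  isRD = record
    { blockSize   = blockSize
    ; replication = replication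
    ; sameRow     = sameRow
    ; sameColumn  = sameColumn
    ; otherwise   = otherwise
    }

  parallelClass-resolves : ∀ q a s → count (n * r) (λ β → ⌊ parallelClass β ≟ q ⌋ ∧ incidence a s β) ≡ 1
  parallelClass-resolves q a s =
    count-unique-remQuot n r (y , q)
      (from (T-∧ {⌊ q ≟ q ⌋}) (fromWitness refl , contains-complete y q Ly≡)) unique
    where
    y = proj₁ (latin-row-surjective (latin a) (suc q) (L a zero s))
    Ly≡ = proj₂ (latin-row-surjective (latin a) (suc q) (L a zero s))

    unique : ∀ p → T (⌊ proj₂ p ≟ q ⌋ ∧ contains a s p) → p ≡ (y , q)
    unique (y′ , x′) h with to (T-∧ {⌊ x′ ≟ q ⌋}) h
    ... | hq , hs with toWitness {a? = x′ ≟ q} hq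
    ... | refl = cong (_, q) (latin-row-injective (latin a) (suc q) (trans (contains-sound y′ q hs) (sym Ly≡)))

  resolvable : Resolvable incidence
  resolvable = r , parallelClass , parallelClass-resolves

  parallelClass-size : ∀ q → count (n * r) (λ β → ⌊ parallelClass β ≟ q ⌋) ≡ n
  parallelClass-size q = trans (count-remQuot n r (λ p → ⌊ proj₂ p ≟ q ⌋))
                               (sumF-ones n (λ _ → count-≟ r q))

  std : STD incidence
  std = r , parallelClass , parallelClass-size , λ a q →
    (1 , parallelClass-resolves q a) , (1 , λ β _ → contains-once-per-square a (remQuot r β))

theorem7 : (m n : ℕ) → 2 ≤ n → MOLS m n →
    Σ (Incidence m n (n * (n ∸ 1))) λ N →
      IsRD m n (n * (n ∸ 1)) (n ∸ 1) m 0 0 1 N ×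
      SemiRegular m n (n ∸ 1) 0 0 1 ×
      STD N ×
      Resolvable N
theorem7 m (suc (suc k)) (s≤s (s≤s z≤n)) mols@(L , latin , orthogonal) =
  incidence , isRD , semiRegular (MOLS-bound mols) , std , resolvable
  where open Construction L latin orthogonal
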